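{- Let $\mathcal{G}=(V,E)$ be a hypergraph with $|V|=n$ in which every hyperedge contains at most $f$ nodes. Let $\beta = 17$, $\alpha = 1+36 f^2\beta^2$, $L=\lceil f\log_\beta n\rceil+1$, and let $\ell: V\to\{0,1,\ldots,L\}$ be any level assignment. For a hyperedge $e$ put $\ell(e)=\max_{v\in e}\ell(v)$ and $w(e)=\beta^{ -\ell(e)}$, and for a node $v$ put $W_v=\sum_{e\in E: v\in e} w(e)$. Suppose that every node $v$ with $\ell(v)>0$ satisfies $1/(\alpha\beta^2) < W_v < 1$, and every node $v$ with $\ell(v)=0$ satisfies $0\le W_v\le 1/\beta^2$. Then the set $\{v\in V: \ell(v)\in\{1,\ldots,L\}\}$ is a vertex cover of $\mathcal{G}$.
   Context: A vertex cover of a hypergraph is a set of nodes intersecting every hyperedge. -}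

module Defs where

open import Data.Nat using (ℕ; zero; suc; _⊔_; _≤_; _^_)
open import Data.Fin using (Fin; toℕ)
open import Data.Fin.Subset using (Subset; _∈_; ∣_∣; Nonempty)
open import Data.Fin.Subset.Properties using (_∈?_)
open import Data.List using (List; []; _∷_; foldr; allFin)
import Data.List.Membership.Propositional as LMem
open import Data.Integer using (+_)
open import Data.Rational using (ℚ; 0ℚ; 1ℚ; _+_; _*_; _/_)
open import Data.Product using (Σ; _×_)
open import Relation.Nullary using (yes; no)

-- A hypergraph on node set V = Fin n: a list of distinct hyperedges,
-- each hyperedge a (nonempty) subset of the nodes.
Hyperedge : ℕ → Set
Hyperedge n = Subset n

β : ℕ
β = 17

α : ℕ → ℕ
α f = 1 Data.Nat.+ 36 Data.Nat.* (f ^ 2) Data.Nat.* (β ^ 2)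

-- k = ⌈ f · log_β n ⌉ (for n ≥ 1): the least natural k with n^f ≤ β^k,
-- since f·log_β n ≤ k  ⇔  n^f ≤ β^k.
IsCeilFLog : (f n k : ℕ) → Set
IsCeilFLog f n k = (n ^ f ≤ β ^ k) × (∀ j → n ^ f ≤ β ^ j → k ≤ j)

invPowβ : ℕ → ℚ
invPowβ zero    = 1ℚ
invPowβ (suc k) = invPowβ k * (+ 1 / 17)

-- ℓ(e) = max_{v ∈ e} ℓ(v)   (levels are ≥ 0, so for nonempty e this is the max)
edgeLevel : ∀ {n L} → (Fin n → Fin (suc L)) → Hyperedge n → ℕ
edgeLevel {n} ℓ e = foldr (λ v acc → lev v ⊔ acc) 0 (allFin n)
  where
  lev : Fin n → ℕ
  lev v with v ∈? e
  ... | yes _ = toℕ (ℓ v)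
  ... | no _  = 0

weight : ∀ {n L} → (Fin n → Fin (suc L)) → Hyperedge n → ℚ
weight ℓ e = invPowβ (edgeLevel ℓ e)

nodeWeight : ∀ {n L} → (Fin n → Fin (suc L)) → List (Hyperedge n) → Fin n → ℚ
nodeWeight ℓ [] v = 0ℚ
nodeWeight ℓ (e ∷ E) v with v ∈? e
... | yes _ = weight ℓ e + nodeWeight ℓ E v
... | no _  = nodeWeight ℓ E v

IsVertexCover : ∀ {n} → List (Hyperedge n) → (Fin n → Set) → Set
IsVertexCover {n} E C = ∀ e → e LMem.∈ E → Σ (Fin n) λ v → (v ∈ e) × C v

lowerW : ℕ → ℚ
lowerW f = (+ 1 / α f) * invPowβ 2

zeroUpperW : ℚ
zeroUpperW = invPowβ 2

-- If some hyperedge e had no node of positive level, then ℓ(e) = 0 and w(e) = 1, so every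
-- node v ∈ e (of level 0) would have W_v ≥ w(e) = 1 > 1/β².
module Submission where

open import Defs
open import Data.Nat using (ℕ; suc; z≤n; _≤_; _<_; _⊔_)
open import Data.Nat.Properties using (⊔-lub; n≤0⇒n≡0; ≮⇒≥; _≤?_)
open import Data.Fin using (Fin; toℕ)
open import Data.Fin.Properties using (any?)
open import Data.Fin.Subset using (∣_∣; Nonempty) renaming (_∈_ to _∈ₛ_)
open import Data.Fin.Subset.Properties using (_∈?_)
open import Data.List using (List; []; _∷_; foldr; allFin)
open import Data.List.Relation.Unary.All as All using (All)
open import Data.List.Relation.Unary.Any using (here; there)
open import Data.List.Relation.Unary.Unique.Propositional using (Unique)
open import Data.List.Membership.Propositional using (_∈_)
open import Data.Rational using (0ℚ; 1ℚ; _+_; _/_)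
  renaming (_<_ to _<ℚ_; _≤_ to _≤ℚ_; _≤?_ to _≤ℚ?_)
open import Data.Rational.Properties
  using ( ≤-refl; ≤-trans; nonNegative⁻¹; +-monoˡ-≤; +-monoʳ-≤; +-mono-≤; +-identityˡ; +-identityʳ
        ; *-monoʳ-≤-nonNeg; module ≤-Reasoning)
open import Data.Integer using (+_)
open import Data.Product using (_×_; _,_; proj₂)
open import Data.Empty using (⊥-elim)
open import Relation.Binary.PropositionalEquality using (_≡_; refl; sym; subst)
open import Relation.Nullary using (yes; no; ¬_)
open import Relation.Nullary.Decidable using (toWitnessFalse; _×-dec_)

invPowβ-nonNeg : ∀ k → 0ℚ ≤ℚ invPowβ k
invPowβ-nonNeg 0       = nonNegative⁻¹ 1ℚ
invPowβ-nonNeg (suc k) = *-monoʳ-≤-nonNeg (+ 1 / 17) (invPowβ-nonNeg k)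

foldr-⊔-≤ : ∀ {A : Set} {m} (g : A → ℕ) → (∀ x → g x ≤ m) → ∀ xs → foldr (λ x acc → g x ⊔ acc) 0 xs ≤ m
foldr-⊔-≤ g g≤m []       = z≤n
foldr-⊔-≤ g g≤m (x ∷ xs) = ⊔-lub (g≤m x) (foldr-⊔-≤ g g≤m xs)

module _ {n L : ℕ} (ℓ : Fin n → Fin (suc L)) where

  nodeWeight-nonNeg : ∀ E v → 0ℚ ≤ℚ nodeWeight ℓ E v
  nodeWeight-nonNeg []      v = ≤-refl
  nodeWeight-nonNeg (e ∷ E) v with v ∈? e
  ... | yes _ = +-mono-≤ (invPowβ-nonNeg (edgeLevel ℓ e)) (nodeWeight-nonNeg E v)
  ... | no _  = nodeWeight-nonNeg E v

  weight≤nodeWeight : ∀ {E e v} → e ∈ E → v ∈ₛ e → weight ℓ e ≤ℚ nodeWeight ℓ E v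
  weight≤nodeWeight {e ∷ E} {v = v} (here refl) v∈e with v ∈? e
  ... | no v∉e = ⊥-elim (v∉e v∈e)
  ... | yes _  = begin
    weight ℓ e               ≡⟨ sym (+-identityʳ (weight ℓ e)) ⟩
    weight ℓ e + 0ℚ          ≤⟨ +-monoʳ-≤ (weight ℓ e) (nodeWeight-nonNeg E v) ⟩
    weight ℓ e + nodeWeight ℓ E v ∎
    where open ≤-Reasoning
  weight≤nodeWeight {f ∷ E} {e} {v} (there e∈E) v∈e with v ∈? f
  ... | no _  = weight≤nodeWeight e∈E v∈e
  ... | yes _ = begin
    weight ℓ e               ≤⟨ weight≤nodeWeight e∈E v∈e ⟩
    nodeWeight ℓ E v         ≡⟨ sym (+-identityˡ (nodeWeight ℓ E v)) ⟩
    0ℚ + nodeWeight ℓ E v    ≤⟨ +-monoˡ-≤ (nodeWeight ℓ E v) (invPowβ-nonNeg (edgeLevel ℓ f)) ⟩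
    weight ℓ f + nodeWeight ℓ E v ∎
    where open ≤-Reasoning

  edgeLevel-≤ : ∀ e m → (∀ v → v ∈ₛ e → toℕ (ℓ v) ≤ m) → edgeLevel ℓ e ≤ m
  edgeLevel-≤ e m bound = edgeLevel≤m
    where
    -- The summand of edgeLevel is a local function of Defs, out of scope here; the hole is
    -- filled by unification in edgeLevel≤m, which is why this signature precedes it.
    level≤m : ∀ v → _ ≤ m
    edgeLevel≤m : edgeLevel ℓ e ≤ m
    edgeLevel≤m = foldr-⊔-≤ _ level≤m (allFin n)
    level≤m v with v ∈? e
    ... | yes v∈e = bound v v∈e
    ... | no _    = z≤n

  1≤nodeWeight : ∀ {E e v} → e ∈ E → v ∈ₛ e → (∀ u → u ∈ₛ e → toℕ (ℓ u) ≤ 0)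
               → 1ℚ ≤ℚ nodeWeight ℓ E v
  1≤nodeWeight {E} {e} {v} e∈E v∈e ground =
    subst (λ k → invPowβ k ≤ℚ nodeWeight ℓ E v) (n≤0⇒n≡0 (edgeLevel-≤ e 0 ground))
      (weight≤nodeWeight e∈E v∈e)

1≰zeroUpperW : ¬ (1ℚ ≤ℚ zeroUpperW)
1≰zeroUpperW = toWitnessFalse {a? = 1ℚ ≤ℚ? zeroUpperW} _

corollary1 : (n f : ℕ) (E : List (Hyperedge n))
    → Unique E
    → All Nonempty E
    → All (λ e → ∣ e ∣ ≤ f) E
    → (k : ℕ) → IsCeilFLog f n k
    → (L : ℕ) → L ≡ suc k
    → (ℓ : Fin n → Fin (suc L))
    → (∀ v → 0 < toℕ (ℓ v) → (lowerW f <ℚ nodeWeight ℓ E v) × (nodeWeight ℓ E v <ℚ 1ℚ))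
    → (∀ v → toℕ (ℓ v) ≡ 0 → (0ℚ ≤ℚ nodeWeight ℓ E v) × (nodeWeight ℓ E v ≤ℚ zeroUpperW))
    → IsVertexCover E (λ v → 1 ≤ toℕ (ℓ v))
corollary1 n f E _ nonempty _ k _ L _ ℓ _ level0 e e∈E
  with any? (λ v → (v ∈? e) ×-dec (1 ≤? toℕ (ℓ v))) | All.lookup nonempty e∈E
... | yes covered  | _         = covered
... | no uncovered | (v , v∈e) =
  ⊥-elim (1≰zeroUpperW (≤-trans (1≤nodeWeight ℓ e∈E v∈e ground) W≤zeroUpperW))
  where
  ground : ∀ u → u ∈ₛ e → toℕ (ℓ u) ≤ 0
  ground u u∈e = ≮⇒≥ (λ positive → uncovered (u , u∈e , positive))
  W≤zeroUpperW : nodeWeight ℓ E v ≤ℚ zeroUpperW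
  W≤zeroUpperW = proj₂ (level0 v (n≤0⇒n≡0 (ground v v∈e)))
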